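{- Assume $\mathbb T$ is propositionally stable and that (SQCI) holds ($\mathbb I$ is stably quasi-coherent). Then the open propositions form a dominance: the proposition $\top$ is open, and whenever $p$ is an open proposition and $q$ is a proposition such that $p\to(q\text{ is open})$, the proposition $p\wedge q$ (i.e. $\sum_{w:p}q$) is open. (Here the subuniverse of open propositions is identified with $\mathbb I$ via $i\mapsto(i=1)$.)
   Context: We work in intensional type theory with function extensionality (univalent conventions; $\exists$, $\vee$ are truncated). $\mathbb I$ is a model of a Horn theory $\mathbb T$. An $\mathbb I$-algebra is a $\mathbb T$-model $A$ with a homomorphism $\mathbb I\to A$. $\operatorname{Spec}A:=\mathbb I\text{ - }\mathbf{Alg}(A,\mathbb I)$; $\mathcal O X:=\mathbb I^X$ with pointwise structure. $A$ is quasi-coherent if $\iota_A:A\to\mathcal O\operatorname{Spec}A$, $a\mapsto(x\mapsto x(a))$, is an isomorphism. $A$ is stably quasi-coherent if all quotients $A/(a=b)$ for $n:\mathbb N$, $a,b:n\to A$ are quasi-coherent. (SQCI): $\mathbb I$ is stably quasi-coherent. $\mathbb T$ is propositionally stable if it extends bounded meet-semilattices and, for every model $A$ and $a:A$, the quotient $A/(a=1)$ is $a\wedge-:A\to{\downarrow}a$. A proposition $p$ is open if $p\leftrightarrow(i=1)$ for some $i:\mathbb I$. -}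

module Defs where

open import Level using (Level)
open import Data.Nat using (ℕ)
open import Data.Fin using (Fin; zero; suc)
open import Data.Product using (Σ; _×_; _,_; proj₁; proj₂)
open import Relation.Binary.PropositionalEquality using (_≡_; subst; sym)

isProp : Set → Set
isProp A = (x y : A) → x ≡ y

isSet : Set → Set
isSet A = (x y : A) → isProp (x ≡ y)

-- Propositional truncation, encoded impredicatively (elimination into
-- propositions of the base universe).
∥_∥ : Set → Set₁
∥ A ∥ = (P : Set) → isProp P → (A → P) → P

_↔_ : Set → Set → Set
A ↔ B = (A → B) × (B → A)

record Signature : Set₁ where
  field
    Op    : Set
    arity : Op → ℕ

open Signature public

data Term (S : Signature) (n : ℕ) : Set where
  var : Fin n → Term S n
  app : (o : Op S) → (Fin (arity S o) → Term S n) → Term S n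

-- Horn clause:  s₁ = t₁ ∧ … ∧ sₖ = tₖ  →  s = t   (in nvars variables)
record HornClause (S : Signature) : Set where
  field
    nvars : ℕ
    nhyps : ℕ
    hyps  : Fin nhyps → Term S nvars × Term S nvars
    concl : Term S nvars × Term S nvars

open HornClause public

record Theory : Set₁ where
  field
    sig   : Signature
    Ax    : Set
    axiom : Ax → HornClause sig

open Theory public

Interp : (S : Signature) → Set → Set
Interp S C = (o : Op S) → (Fin (arity S o) → C) → C

eval : {S : Signature} {C : Set} {n : ℕ} → Interp S C → (Fin n → C) → Term S n → C
eval I ρ (var x)    = ρ x
eval I ρ (app o ts) = I o (λ k → eval I ρ (ts k))

record Structure (T : Theory) (C : Set) : Set where
  field
    carrier-isSet : isSet C
    interp : Interp (sig T) C
    sat : (ax : Ax T) (ρ : Fin (nvars (axiom T ax)) → C) →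
          ((k : Fin (nhyps (axiom T ax))) →
             eval interp ρ (proj₁ (hyps (axiom T ax) k))
               ≡ eval interp ρ (proj₂ (hyps (axiom T ax) k))) →
          eval interp ρ (proj₁ (concl (axiom T ax)))
            ≡ eval interp ρ (proj₂ (concl (axiom T ax)))

open Structure public

Model : Theory → Set₁
Model T = Σ Set (Structure T)

∣_∣ : {T : Theory} → Model T → Set
∣ A ∣ = proj₁ A

op : {T : Theory} (A : Model T) → Interp (sig T) ∣ A ∣
op A = interp (proj₂ A)

IsHomI : {S : Signature} {C D : Set} → Interp S C → Interp S D → (C → D) → Set
IsHomI {S} I J f = (o : Op S) (xs : Fin (arity S o) → _) → f (I o xs) ≡ J o (λ k → f (xs k))

IsHom : {T : Theory} (A B : Model T) → (∣ A ∣ → ∣ B ∣) → Set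
IsHom A B f = IsHomI (op A) (op B) f

-- Quotients A/(a = b), a b : Fin n → A, by their universal property
-- (in T-models; equivalently in I-algebras under A).

record IsQuotient {T : Theory} (A Q : Model T) (n : ℕ) (a b : Fin n → ∣ A ∣)
                  (π : ∣ A ∣ → ∣ Q ∣) : Set₁ where
  field
    π-hom  : IsHom A Q π
    π-resp : (k : Fin n) → π (a k) ≡ π (b k)
    univ   : (B : Model T) (f : ∣ A ∣ → ∣ B ∣) → IsHom A B f →
             ((k : Fin n) → f (a k) ≡ f (b k)) →
             Σ (∣ Q ∣ → ∣ B ∣) λ g →
               IsHom Q B g × ((x : ∣ A ∣) → g (π x) ≡ f x)
               × ((g' : ∣ Q ∣ → ∣ B ∣) → IsHom Q B g' →
                   ((x : ∣ A ∣) → g' (π x) ≡ f x) → (y : ∣ Q ∣) → g' y ≡ g y)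

open IsQuotient public

module _ {T : Theory} (I : Model T) where

  IAlg : Set₁
  IAlg = Σ (Model T) λ A → Σ (∣ I ∣ → ∣ A ∣) (IsHom I A)

  Spec : IAlg → Set
  Spec (A , η , _) =
    Σ (∣ A ∣ → ∣ I ∣) λ f → IsHom A I f × ((i : ∣ I ∣) → f (η i) ≡ i)

  O-interp : (X : Set) → Interp (sig T) (X → ∣ I ∣)
  O-interp X o fs = λ x → op I o (λ k → fs k x)

  ι : (A : IAlg) → ∣ proj₁ A ∣ → (Spec A → ∣ I ∣)
  ι A a x = proj₁ x a

  -- ι_A is an isomorphism of I-algebras A ≅ 𝒪 Spec A
  IsQuasiCoherent : IAlg → Set
  IsQuasiCoherent A@(B , η , _) =
    IsHomI (op B) (O-interp (Spec A)) (ι A)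
    × ((i : ∣ I ∣) → ι A (η i) ≡ (λ _ → i))
    × Σ ((Spec A → ∣ I ∣) → ∣ B ∣) λ g →
        ((a : ∣ B ∣) → g (ι A a) ≡ a) × ((φ : Spec A → ∣ I ∣) → ι A (g φ) ≡ φ)

  SQCI : Set₁
  SQCI = (n : ℕ) (a b : Fin n → ∣ I ∣) (Q : Model T) (π : ∣ I ∣ → ∣ Q ∣)
         (q : IsQuotient I Q n a b π) → IsQuasiCoherent (Q , π , π-hom q)

args2 : {C : Set} → C → C → Fin 2 → C
args2 x y zero    = x
args2 x y (suc _) = y

args0 : {C : Set} → Fin 0 → C
args0 ()

record PropStable (T : Theory) : Set₁ where
  field
    meet    : Op (sig T)
    meet-ar : arity (sig T) meet ≡ 2
    top     : Op (sig T)
    top-ar  : arity (sig T) top ≡ 0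

  _∧⟨_⟩_ : {C : Set} → C → Interp (sig T) C → C → C
  x ∧⟨ J ⟩ y = J meet (subst (λ m → Fin m → _) (sym meet-ar) (args2 x y))

  one : {C : Set} → Interp (sig T) C → C
  one J = J top (subst (λ m → Fin m → _) (sym top-ar) args0)

  ↓ : (A : Model T) → ∣ A ∣ → Set
  ↓ A a = Σ ∣ A ∣ λ x → x ∧⟨ op A ⟩ a ≡ x

  field
    ∧-idem  : (A : Model T) (x : ∣ A ∣) → x ∧⟨ op A ⟩ x ≡ x
    ∧-comm  : (A : Model T) (x y : ∣ A ∣) → x ∧⟨ op A ⟩ y ≡ y ∧⟨ op A ⟩ x
    ∧-assoc : (A : Model T) (x y z : ∣ A ∣) →
              (x ∧⟨ op A ⟩ y) ∧⟨ op A ⟩ z ≡ x ∧⟨ op A ⟩ (y ∧⟨ op A ⟩ z)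
    ∧-top   : (A : Model T) (x : ∣ A ∣) → x ∧⟨ op A ⟩ one (op A) ≡ x
    down-quot : (A : Model T) (a : ∣ A ∣) →
      Σ (Structure T (↓ A a)) λ S →
      Σ (∣ A ∣ → ↓ A a) λ r →
        ((x : ∣ A ∣) → proj₁ (r x) ≡ a ∧⟨ op A ⟩ x)
        × IsQuotient A (↓ A a , S) 1 (λ _ → a) (λ _ → one (op A)) r

open PropStable public

IsOpen : {T : Theory} → PropStable T → Model T → Set → Set₁
IsOpen PS I p = ∥ Σ ∣ I ∣ (λ i → p ↔ (i ≡ one PS (op I))) ∥

module Submission where

-- Propositional stability identifies the quotient I/(i = 1) with ↓i, whose
-- points over I are exactly the proofs of i = 1; (SQCI) then makes
-- ↓i ≅ I^(i = 1).  Injectivity of this isomorphism shows i ∧ j = i as soon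
-- as i = 1 implies j = 1, so the code of an open proposition is unique and
-- can be extracted from a truncation.  For p ↔ (i = 1) with p → (q open),
-- this yields a function (i = 1) → I choosing codes of q, and surjectivity
-- glues it into a single k ≤ i, which is the code of p ∧ q.

open import Defs
open import Data.Unit using (⊤; tt)
open import Data.Product using (Σ; _×_; _,_; proj₁; proj₂)
open import Function using (id)
open import Relation.Binary.PropositionalEquality
open import Axiom.Extensionality.Propositional using (Extensionality)

Σ-≡-prop : {A : Set} {B : A → Set} → ((a : A) → isProp (B a)) →
           {x y : Σ A B} → proj₁ x ≡ proj₁ y → x ≡ y
Σ-≡-prop isProp-B {a , b} {.a , b′} refl = cong (a ,_) (isProp-B a b b′)

module OpenPropositions (T : Theory) (PS : PropStable T) (I : Model T) where

  C : Set
  C = ∣ I ∣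

  _⊓_ : C → C → C
  x ⊓ y = _∧⟨_⟩_ PS x (op I) y

  𝟙 : C
  𝟙 = one PS (op I)

  OpenCode : Set → Set
  OpenCode p = Σ C λ i → p ↔ (i ≡ 𝟙)

  ≡𝟙-of-≤ : {k i : C} → k ⊓ i ≡ k → k ≡ 𝟙 → i ≡ 𝟙
  ≡𝟙-of-≤ {k} {i} k≤i k≡𝟙 = begin
    i        ≡⟨ sym (∧-top PS I i) ⟩
    i ⊓ 𝟙    ≡⟨ ∧-comm PS I i 𝟙 ⟩
    𝟙 ⊓ i    ≡⟨ cong (_⊓ i) (sym k≡𝟙) ⟩
    k ⊓ i    ≡⟨ k≤i ⟩
    k        ≡⟨ k≡𝟙 ⟩
    𝟙        ∎
    where open ≡-Reasoning

  module Down (i : C) where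

    private
      quotient = down-quot PS I i

    restrict : C → ↓ PS I i
    restrict = proj₁ (proj₂ quotient)

    restrict-val : (x : C) → proj₁ (restrict x) ≡ i ⊓ x
    restrict-val = proj₁ (proj₂ (proj₂ quotient))

    isQuotient : IsQuotient I (↓ PS I i , proj₁ quotient) 1 (λ _ → i) (λ _ → 𝟙) restrict
    isQuotient = proj₂ (proj₂ (proj₂ quotient))

    DownAlg : IAlg I
    DownAlg = (↓ PS I i , proj₁ quotient) , restrict , π-hom isQuotient

    Point : Set
    Point = Spec I DownAlg

    ↓-≡ : {y y′ : ↓ PS I i} → proj₁ y ≡ proj₁ y′ → y ≡ y′
    ↓-≡ = Σ-≡-prop λ _ → carrier-isSet (proj₂ I) _ _

    restrict-proj₁ : (y : ↓ PS I i) → restrict (proj₁ y) ≡ y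
    restrict-proj₁ (y , y≤i) = ↓-≡ (trans (restrict-val y) (trans (∧-comm PS I i y) y≤i))

    restrict-self≡restrict-𝟙 : restrict i ≡ restrict 𝟙
    restrict-self≡restrict-𝟙 = ↓-≡ (begin
      proj₁ (restrict i)  ≡⟨ restrict-val i ⟩
      i ⊓ i               ≡⟨ ∧-idem PS I i ⟩
      i                   ≡⟨ sym (∧-top PS I i) ⟩
      i ⊓ 𝟙               ≡⟨ sym (restrict-val 𝟙) ⟩
      proj₁ (restrict 𝟙)  ∎)
      where open ≡-Reasoning

    point-restrict : (x : Point) (c : C) → proj₁ x (restrict c) ≡ c
    point-restrict x = proj₂ (proj₂ x)

    point-value : (x : Point) (y : ↓ PS I i) → proj₁ x y ≡ proj₁ y
    point-value x y = trans (cong (proj₁ x) (sym (restrict-proj₁ y))) (point-restrict x (proj₁ y))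

    point→≡𝟙 : Point → i ≡ 𝟙
    point→≡𝟙 x = begin
      i                     ≡⟨ sym (point-restrict x i) ⟩
      proj₁ x (restrict i)  ≡⟨ cong (proj₁ x) restrict-self≡restrict-𝟙 ⟩
      proj₁ x (restrict 𝟙)  ≡⟨ point-restrict x 𝟙 ⟩
      𝟙                     ∎
      where open ≡-Reasoning

    ≡𝟙→point : i ≡ 𝟙 → Point
    ≡𝟙→point i≡𝟙 with univ isQuotient I id (λ _ _ → refl) (λ _ → i≡𝟙)
    ... | g , g-hom , g-restrict , _ = g , g-hom , g-restrict

    module QuasiCoherent (qc : IsQuasiCoherent I DownAlg) where

      decode : (Point → C) → ↓ PS I i
      decode = proj₁ (proj₂ (proj₂ qc))

      ι-injective : {y y′ : ↓ PS I i} → ι I DownAlg y ≡ ι I DownAlg y′ → y ≡ y′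
      ι-injective {y} {y′} eq =
        trans (sym (decode-ι y)) (trans (cong decode eq) (decode-ι y′))
        where decode-ι = proj₁ (proj₂ (proj₂ (proj₂ qc)))

      decode-value : (φ : Point → C) (x : Point) → proj₁ (decode φ) ≡ φ x
      decode-value φ x =
        trans (sym (point-value x (decode φ))) (cong (λ f → f x) (ι-decode φ))
        where ι-decode = proj₂ (proj₂ (proj₂ (proj₂ qc)))

  module _ (funext : ∀ {a b} → Extensionality a b) (sqci : SQCI I) where

    private
      module QC (i : C) = Down.QuasiCoherent i
        (sqci 1 (λ _ → i) (λ _ → 𝟙) _ (Down.restrict i) (Down.isQuotient i))

    ⊓-absorb-of-≡𝟙→≡𝟙 : (i j : C) → (i ≡ 𝟙 → j ≡ 𝟙) → i ⊓ j ≡ i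
    ⊓-absorb-of-≡𝟙→≡𝟙 i j i⇒j = begin
      i ⊓ j               ≡⟨ sym (restrict-val j) ⟩
      proj₁ (restrict j)  ≡⟨ cong proj₁ (ι-injective (funext λ x → restrict-j≡restrict-𝟙-at x)) ⟩
      proj₁ (restrict 𝟙)  ≡⟨ restrict-val 𝟙 ⟩
      i ⊓ 𝟙               ≡⟨ ∧-top PS I i ⟩
      i                   ∎
      where
      open ≡-Reasoning
      open Down i
      open QC i
      restrict-j≡restrict-𝟙-at : (x : Point) → proj₁ x (restrict j) ≡ proj₁ x (restrict 𝟙)
      restrict-j≡restrict-𝟙-at x = trans (point-restrict x j)
        (trans (i⇒j (point→≡𝟙 x)) (sym (point-restrict x 𝟙)))

    OpenCode-unique : (i j : C) → (i ≡ 𝟙 → j ≡ 𝟙) → (j ≡ 𝟙 → i ≡ 𝟙) → i ≡ j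
    OpenCode-unique i j i⇒j j⇒i = trans (sym (⊓-absorb-of-≡𝟙→≡𝟙 i j i⇒j))
      (trans (∧-comm PS I i j) (⊓-absorb-of-≡𝟙→≡𝟙 j i j⇒i))

    isProp-OpenCode : (q : Set) → isProp q → isProp (OpenCode q)
    isProp-OpenCode q isProp-q (j , q⇒j , j⇒q) (j′ , q⇒j′ , j′⇒q) =
      Σ-≡-prop isProp-↔ (OpenCode-unique j j′ (λ e → q⇒j′ (j⇒q e)) (λ e → q⇒j (j′⇒q e)))
      where
      isProp-↔ : (k : C) → isProp (q ↔ (k ≡ 𝟙))
      isProp-↔ k _ _ = cong₂ _,_ (funext λ _ → carrier-isSet (proj₂ I) _ _ _ _)
                                 (funext λ _ → isProp-q _ _)

    OpenCode-Σ : (p q : Set) → isProp q → OpenCode p → (p → IsOpen PS I q) →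
                 OpenCode (Σ p λ _ → q)
    OpenCode-Σ p q isProp-q (i , p⇒i , i⇒p) q-open = k , fwd , bwd
      where
      open Down i
      open QC i
      code-q : Point → OpenCode q
      code-q x = q-open (i⇒p (point→≡𝟙 x)) (OpenCode q) (isProp-OpenCode q isProp-q) id
      k : C
      k = proj₁ (decode (λ x → proj₁ (code-q x)))
      k≡code-q : (x : Point) → k ≡ proj₁ (code-q x)
      k≡code-q = decode-value (λ x → proj₁ (code-q x))
      fwd : Σ p (λ _ → q) → k ≡ 𝟙
      fwd (w , v) = trans (k≡code-q x) (proj₁ (proj₂ (code-q x)) v)
        where x = ≡𝟙→point (p⇒i w)
      bwd : k ≡ 𝟙 → Σ p (λ _ → q)
      bwd k≡𝟙 = i⇒p i≡𝟙 , proj₂ (proj₂ (code-q x)) (trans (sym (k≡code-q x)) k≡𝟙)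
        where
        i≡𝟙 = ≡𝟙-of-≤ (proj₂ (decode (λ x → proj₁ (code-q x)))) k≡𝟙
        x = ≡𝟙→point i≡𝟙

proposition3p14 : (funext : ∀ {a b} → Extensionality a b)
    (T : Theory) (PS : PropStable T) (I : Model T) → SQCI I →
    IsOpen PS I ⊤
    × ((p q : Set) → isProp p → isProp q →
       IsOpen PS I p → (p → IsOpen PS I q) → IsOpen PS I (Σ p (λ _ → q)))
proposition3p14 funext T PS I sqci = ⊤-open , Σ-open
  where
  open OpenPropositions T PS I
  ⊤-open : IsOpen PS I ⊤
  ⊤-open _ _ k = k (𝟙 , (λ _ → refl) , (λ _ → tt))
  Σ-open : (p q : Set) → isProp p → isProp q →
           IsOpen PS I p → (p → IsOpen PS I q) → IsOpen PS I (Σ p (λ _ → q))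
  Σ-open p q _ isProp-q p-open q-open P isProp-P k =
    p-open P isProp-P λ code-p → k (OpenCode-Σ funext sqci p q isProp-q code-p q-open)
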